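{- Let $t$ be an integer with $t \ge 2$, let $\Pi_{2} = x \prod_{i=1}^{t} (x^i + x^{i-1} + \cdots + x + 1) \in \mathbb{F}_2[x]$, and let $\tilde{\Pi}_{2}$ be the product of the distinct irreducible polynomials in $\mathbb{F}_2[x]$ dividing $\Pi_{2}$. Then $\deg \tilde{\Pi}_{2} \le \lceil (t+1)/2 \rceil^2$. -}

module Defs where

open import Data.Bool using (Bool; true; false; _xor_; if_then_else_)
open import Data.Nat using (ℕ; zero; suc; _∸_)
open import Data.List using (List; []; _∷_; length; replicate; foldr)
open import Data.Product using (Σ; _×_)
open import Data.Sum using (_⊎_)
open import Relation.Binary.PropositionalEquality using (_≡_)

-- Polynomials over F₂ = Bool (with xor as addition, ∧ as multiplication),
-- represented as coefficient lists, lowest degree first: a₀ ∷ a₁ ∷ … .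
Poly : Set
Poly = List Bool

_⊕_ : Poly → Poly → Poly
[] ⊕ q = q
(a ∷ p) ⊕ [] = a ∷ p
(a ∷ p) ⊕ (b ∷ q) = (a xor b) ∷ (p ⊕ q)

_⊗_ : Poly → Poly → Poly
[] ⊗ q = []
(a ∷ p) ⊗ q = (if a then q else []) ⊕ (false ∷ (p ⊗ q))

private
  cons' : Bool → Poly → Poly
  cons' a [] = if a then true ∷ [] else []
  cons' a (x ∷ xs) = a ∷ x ∷ xs

norm : Poly → Poly
norm [] = []
norm (a ∷ p) = cons' a (norm p)

Normal : Poly → Set
Normal p = norm p ≡ p

-- Degree (degree of the zero polynomial is set to 0; irrelevant here).
deg : Poly → ℕ
deg p = length (norm p) ∸ 1

one : Poly
one = true ∷ []

X : Poly
X = false ∷ true ∷ []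

_∣ₚ_ : Poly → Poly → Set
g ∣ₚ f = Σ Poly (λ q → norm (q ⊗ g) ≡ norm f)

-- Irreducible polynomial in F₂[x] (given in normal form): nonconstant and
-- every factorisation has a unit factor (the only unit of F₂[x] is 1).
Irreducible : Poly → Set
Irreducible p = Normal p × (1 Data.Nat.≤ deg p) ×
  ((a b : Poly) → norm (a ⊗ b) ≡ p → (norm a ≡ one) ⊎ (norm b ≡ one))

geom : ℕ → Poly
geom i = replicate (suc i) true

prodGeom : ℕ → Poly
prodGeom zero = one
prodGeom (suc t) = prodGeom t ⊗ geom (suc t)

Π₂ : ℕ → Poly
Π₂ t = X ⊗ prodGeom t

prodList : List Poly → Poly
prodList = foldr _⊗_ one

-- Over F₂ we have 1 + x + ⋯ + x^(2j+1) = (1 + x)(1 + x + ⋯ + xʲ)², so by Euclid's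
-- lemma every irreducible factor of Π₂ divides x, 1 + x, or one of the even-degree
-- sums 1 + x + ⋯ + x^(2j) with 2j ≤ t.  A product of distinct irreducibles each
-- dividing D = x (1 + x) ∏_{j=1}^{m} (1 + x + ⋯ + x^(2j)), m = ⌊t/2⌋, divides D,
-- so its degree is at most deg D = 2 + m(m + 1) ≤ (m + 1)² = ⌈(t + 1)/2⌉², using m ≥ 1.
module Submission where

open import Defs
open import Data.Bool using (Bool; true; false; _xor_; if_then_else_)
open import Data.Bool.Properties using (xor-comm; xor-assoc; xor-same)
open import Data.Nat using (ℕ; zero; suc; _+_; _*_; _∸_; _≤_; _<_; _^_; ⌈_/2⌉; ⌊_/2⌋; z≤n; s≤s; z<s; _≟_)
open import Data.Nat.Properties
open import Data.Nat.Induction using (<-rec)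
open import Data.Nat.Tactic.RingSolver using (solve-∀)
open import Data.List using (List; []; _∷_; length; replicate; _++_)
open import Data.List.Properties using (length-++; length-replicate)
open import Data.List.Membership.Propositional using (_∈_)
open import Data.List.Relation.Unary.All as All using (All; []; _∷_)
open import Data.List.Relation.Unary.AllPairs using ([]; _∷_)
open import Data.List.Relation.Unary.Unique.Propositional using (Unique)
open import Data.Product using (_×_; ∃-syntax; _,_; proj₁)
open import Data.Sum using (_⊎_; inj₁; inj₂)
open import Data.Empty using (⊥-elim)
open import Relation.Nullary using (yes; no; ¬_)
open import Level using (0ℓ)
open import Relation.Binary.Bundles using (Setoid)
open import Relation.Binary.PropositionalEquality
import Relation.Binary.Reasoning.Setoid as SetoidReasoning

⊕-identityʳ : ∀ p → p ⊕ [] ≡ p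
⊕-identityʳ []      = refl
⊕-identityʳ (_ ∷ _) = refl

⊕-comm : ∀ p q → p ⊕ q ≡ q ⊕ p
⊕-comm []      []      = refl
⊕-comm []      (_ ∷ _) = refl
⊕-comm (_ ∷ _) []      = refl
⊕-comm (a ∷ p) (b ∷ q) = cong₂ _∷_ (xor-comm a b) (⊕-comm p q)

⊕-assoc : ∀ p q r → (p ⊕ q) ⊕ r ≡ p ⊕ (q ⊕ r)
⊕-assoc []      q       r       = refl
⊕-assoc (_ ∷ _) []      r       = refl
⊕-assoc (_ ∷ _) (_ ∷ _) []      = refl
⊕-assoc (a ∷ p) (b ∷ q) (c ∷ r) = cong₂ _∷_ (xor-assoc a b c) (⊕-assoc p q r)

⊕-swap : ∀ p q r → p ⊕ (q ⊕ r) ≡ q ⊕ (p ⊕ r)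
⊕-swap p q r = begin
  p ⊕ (q ⊕ r)   ≡⟨ ⊕-assoc p q r ⟨
  (p ⊕ q) ⊕ r   ≡⟨ cong (_⊕ r) (⊕-comm p q) ⟩
  (q ⊕ p) ⊕ r   ≡⟨ ⊕-assoc q p r ⟩
  q ⊕ (p ⊕ r)   ∎
  where open ≡-Reasoning

⊕-interchange : ∀ p q r s → (p ⊕ q) ⊕ (r ⊕ s) ≡ (p ⊕ r) ⊕ (q ⊕ s)
⊕-interchange p q r s = begin
  (p ⊕ q) ⊕ (r ⊕ s)   ≡⟨ ⊕-assoc p q (r ⊕ s) ⟩
  p ⊕ (q ⊕ (r ⊕ s))   ≡⟨ cong (p ⊕_) (⊕-swap q r s) ⟩
  p ⊕ (r ⊕ (q ⊕ s))   ≡⟨ ⊕-assoc p r (q ⊕ s) ⟨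
  (p ⊕ r) ⊕ (q ⊕ s)   ∎
  where open ≡-Reasoning

-- The private cons' of Defs.
cons : Bool → Poly → Poly
cons a []      = if a then true ∷ [] else []
cons a (b ∷ p) = a ∷ b ∷ p

norm-∷ : ∀ a p → norm (a ∷ p) ≡ cons a (norm p)
norm-∷ a p with norm p
... | []    = refl
... | _ ∷ _ = refl

norm-cons : ∀ a p → norm (cons a p) ≡ cons a (norm p)
norm-cons true  []      = refl
norm-cons false []      = refl
norm-cons a     (b ∷ p) = norm-∷ a (b ∷ p)

norm-idem : ∀ p → Normal (norm p)
norm-idem []      = refl
norm-idem (a ∷ p) rewrite norm-∷ a p = trans (norm-cons a (norm p)) (cong (cons a) (norm-idem p))

cons-⊕ : ∀ a p b q → cons a p ⊕ (b ∷ q) ≡ (a xor b) ∷ (p ⊕ q)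
cons-⊕ true  []      b q = refl
cons-⊕ false []      b q = refl
cons-⊕ a     (_ ∷ _) b q = refl

norm-⊕ˡ : ∀ p q → norm (p ⊕ q) ≡ norm (norm p ⊕ q)
norm-⊕ˡ []      q       = refl
norm-⊕ˡ (a ∷ p) []      = trans (sym (norm-idem (a ∷ p))) (cong norm (sym (⊕-identityʳ (norm (a ∷ p)))))
norm-⊕ˡ (a ∷ p) (b ∷ q) = begin
  norm ((a xor b) ∷ (p ⊕ q))           ≡⟨ norm-∷ (a xor b) (p ⊕ q) ⟩
  cons (a xor b) (norm (p ⊕ q))        ≡⟨ cong (cons (a xor b)) (norm-⊕ˡ p q) ⟩
  cons (a xor b) (norm (norm p ⊕ q))   ≡⟨ norm-∷ (a xor b) (norm p ⊕ q) ⟨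
  norm ((a xor b) ∷ (norm p ⊕ q))      ≡⟨ cong norm (cons-⊕ a (norm p) b q) ⟨
  norm (cons a (norm p) ⊕ (b ∷ q))     ≡⟨ cong (λ r → norm (r ⊕ (b ∷ q))) (norm-∷ a p) ⟨
  norm (norm (a ∷ p) ⊕ (b ∷ q))        ∎
  where open ≡-Reasoning

-- Equality up to normal form

infix 4 _≈_
record _≈_ (p q : Poly) : Set where
  constructor mk≈
  field norm-≡ : norm p ≡ norm q
open _≈_ public

≈-refl : ∀ {p} → p ≈ p
≈-refl = mk≈ refl

≈-sym : ∀ {p q} → p ≈ q → q ≈ p
≈-sym (mk≈ e) = mk≈ (sym e)

≈-trans : ∀ {p q r} → p ≈ q → q ≈ r → p ≈ r
≈-trans (mk≈ e) (mk≈ f) = mk≈ (trans e f)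

≈-setoid : Setoid 0ℓ 0ℓ
≈-setoid = record
  { Carrier       = Poly
  ; _≈_           = _≈_
  ; isEquivalence = record { refl = ≈-refl ; sym = ≈-sym ; trans = ≈-trans }
  }

module ≈-Reasoning = SetoidReasoning ≈-setoid

≡⇒≈ : ∀ {p q} → p ≡ q → p ≈ q
≡⇒≈ refl = ≈-refl

norm-≈ : ∀ p → norm p ≈ p
norm-≈ p = mk≈ (norm-idem p)

∷-cong : ∀ a {p q} → p ≈ q → a ∷ p ≈ a ∷ q
∷-cong a {p} {q} (mk≈ e) = mk≈ (trans (norm-∷ a p) (trans (cong (cons a) e) (sym (norm-∷ a q))))

⊕-congʳ : ∀ {p p′} q → p ≈ p′ → p ⊕ q ≈ p′ ⊕ q
⊕-congʳ {p} {p′} q (mk≈ e) =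
  mk≈ (trans (norm-⊕ˡ p q) (trans (cong (λ r → norm (r ⊕ q)) e) (sym (norm-⊕ˡ p′ q))))

⊕-congˡ : ∀ p {q q′} → q ≈ q′ → p ⊕ q ≈ p ⊕ q′
⊕-congˡ p {q} {q′} q≈q′ = begin
  p ⊕ q    ≡⟨ ⊕-comm p q ⟩
  q ⊕ p    ≈⟨ ⊕-congʳ p q≈q′ ⟩
  q′ ⊕ p   ≡⟨ ⊕-comm q′ p ⟩
  p ⊕ q′   ∎
  where open ≈-Reasoning

⊕-cong : ∀ {p p′ q q′} → p ≈ p′ → q ≈ q′ → p ⊕ q ≈ p′ ⊕ q′
⊕-cong {p} {p′} {q} {q′} p≈p′ q≈q′ = begin
  p ⊕ q     ≈⟨ ⊕-congʳ q p≈p′ ⟩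
  p′ ⊕ q    ≈⟨ ⊕-congˡ p′ q≈q′ ⟩
  p′ ⊕ q′   ∎
  where open ≈-Reasoning

⊕-same : ∀ p → p ⊕ p ≈ []
⊕-same []      = ≈-refl
⊕-same (a ∷ p) =
  mk≈ (trans (norm-∷ (a xor a) (p ⊕ p)) (cong₂ cons (xor-same a) (norm-≡ (⊕-same p))))

⊕-cancelʳ : ∀ p q → (p ⊕ q) ⊕ q ≈ p
⊕-cancelʳ p q = begin
  (p ⊕ q) ⊕ q   ≡⟨ ⊕-assoc p q q ⟩
  p ⊕ (q ⊕ q)   ≈⟨ ⊕-cong ≈-refl (⊕-same q) ⟩
  p ⊕ []        ≡⟨ ⊕-identityʳ p ⟩
  p             ∎
  where open ≈-Reasoning

cons-⊗ : ∀ a p q → cons a p ⊗ q ≈ (a ∷ p) ⊗ q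
cons-⊗ true  []      q = ≈-refl
cons-⊗ false []      q = mk≈ refl
cons-⊗ a     (_ ∷ _) q = ≈-refl

⊗-normˡ : ∀ p q → p ⊗ q ≈ norm p ⊗ q
⊗-normˡ []      q = ≈-refl
⊗-normˡ (a ∷ p) q = begin
  (if a then q else []) ⊕ (false ∷ (p ⊗ q))        ≈⟨ ⊕-cong ≈-refl (∷-cong false (⊗-normˡ p q)) ⟩
  (if a then q else []) ⊕ (false ∷ (norm p ⊗ q))   ≈⟨ ≈-sym (cons-⊗ a (norm p) q) ⟩
  cons a (norm p) ⊗ q                               ≡⟨ cong (_⊗ q) (norm-∷ a p) ⟨
  norm (a ∷ p) ⊗ q                                  ∎
  where open ≈-Reasoning

if-norm : ∀ a q → (if a then q else []) ≈ (if a then norm q else [])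
if-norm true  q = ≈-sym (norm-≈ q)
if-norm false q = ≈-refl

⊗-normʳ : ∀ p q → p ⊗ q ≈ p ⊗ norm q
⊗-normʳ []      q = ≈-refl
⊗-normʳ (a ∷ p) q = ⊕-cong (if-norm a q) (∷-cong false (⊗-normʳ p q))

⊗-cong : ∀ {p p′ q q′} → p ≈ p′ → q ≈ q′ → p ⊗ q ≈ p′ ⊗ q′
⊗-cong {p} {p′} {q} {q′} (mk≈ e) (mk≈ f) = begin
  p ⊗ q              ≈⟨ ⊗-normˡ p q ⟩
  norm p ⊗ q         ≡⟨ cong (_⊗ q) e ⟩
  norm p′ ⊗ q        ≈⟨ ≈-sym (⊗-normˡ p′ q) ⟩
  p′ ⊗ q             ≈⟨ ⊗-normʳ p′ q ⟩
  p′ ⊗ norm q        ≡⟨ cong (p′ ⊗_) f ⟩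
  p′ ⊗ norm q′       ≈⟨ ≈-sym (⊗-normʳ p′ q′) ⟩
  p′ ⊗ q′            ∎
  where open ≈-Reasoning

⊗-congˡ : ∀ p {q q′} → q ≈ q′ → p ⊗ q ≈ p ⊗ q′
⊗-congˡ p = ⊗-cong (≈-refl {p})

⊗-congʳ : ∀ {p p′} q → p ≈ p′ → p ⊗ q ≈ p′ ⊗ q
⊗-congʳ q p≈p′ = ⊗-cong p≈p′ (≈-refl {q})

⊗-zeroʳ : ∀ p → p ⊗ [] ≈ []
⊗-zeroʳ []          = ≈-refl
⊗-zeroʳ (true ∷ p)  = ≈-trans (∷-cong false (⊗-zeroʳ p)) (mk≈ refl)
⊗-zeroʳ (false ∷ p) = ≈-trans (∷-cong false (⊗-zeroʳ p)) (mk≈ refl)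

⊗-∷ʳ : ∀ p a q → p ⊗ (a ∷ q) ≈ (if a then p else []) ⊕ (false ∷ (p ⊗ q))
⊗-∷ʳ []      true  q = mk≈ refl
⊗-∷ʳ []      false q = mk≈ refl
⊗-∷ʳ (b ∷ p) a     q =
  ≈-trans (⊕-cong ≈-refl (∷-cong false (⊗-∷ʳ p a q))) (≡⇒≈ (exchange a b))
  where
  exchange : ∀ a b →
    (if b then a ∷ q else []) ⊕ (false ∷ ((if a then p else []) ⊕ (false ∷ (p ⊗ q))))
      ≡ (if a then b ∷ p else []) ⊕ (false ∷ ((if b then q else []) ⊕ (false ∷ (p ⊗ q))))
  exchange false false = refl
  exchange true  false = refl
  exchange false true  = refl
  exchange true  true  = cong (true ∷_) (⊕-swap q p (false ∷ (p ⊗ q)))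

⊗-comm : ∀ p q → p ⊗ q ≈ q ⊗ p
⊗-comm []      q = ≈-sym (⊗-zeroʳ q)
⊗-comm (a ∷ p) q = ≈-trans (⊕-cong ≈-refl (∷-cong false (⊗-comm p q))) (≈-sym (⊗-∷ʳ q a p))

⊗-identityˡ : ∀ p → one ⊗ p ≈ p
⊗-identityˡ p = begin
  one ⊗ p            ≡⟨⟩
  p ⊕ (false ∷ [])   ≡⟨ ⊕-comm p (false ∷ []) ⟩
  (false ∷ []) ⊕ p   ≈⟨ ⊕-congʳ p (mk≈ {false ∷ []} {[]} refl) ⟩
  [] ⊕ p             ≡⟨⟩
  p                  ∎
  where open ≈-Reasoning

⊗-identityʳ : ∀ p → p ⊗ one ≈ p
⊗-identityʳ p = ≈-trans (⊗-comm p one) (⊗-identityˡ p)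

⊗-distribˡ-⊕ : ∀ p q r → p ⊗ (q ⊕ r) ≡ (p ⊗ q) ⊕ (p ⊗ r)
⊗-distribˡ-⊕ []          q r = refl
⊗-distribˡ-⊕ (true ∷ p)  q r rewrite ⊗-distribˡ-⊕ p q r =
  ⊕-interchange q r (false ∷ (p ⊗ q)) (false ∷ (p ⊗ r))
⊗-distribˡ-⊕ (false ∷ p) q r rewrite ⊗-distribˡ-⊕ p q r = refl

⊗-distribʳ-⊕ : ∀ p q r → (p ⊕ q) ⊗ r ≈ (p ⊗ r) ⊕ (q ⊗ r)
⊗-distribʳ-⊕ p q r = begin
  (p ⊕ q) ⊗ r         ≈⟨ ⊗-comm (p ⊕ q) r ⟩
  r ⊗ (p ⊕ q)         ≡⟨ ⊗-distribˡ-⊕ r p q ⟩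
  (r ⊗ p) ⊕ (r ⊗ q)   ≈⟨ ⊕-cong (⊗-comm r p) (⊗-comm r q) ⟩
  (p ⊗ r) ⊕ (q ⊗ r)   ∎
  where open ≈-Reasoning

if-⊗ : ∀ a p q → (if a then p else []) ⊗ q ≡ (if a then p ⊗ q else [])
if-⊗ true  p q = refl
if-⊗ false p q = refl

⊗-assoc : ∀ p q r → (p ⊗ q) ⊗ r ≈ p ⊗ (q ⊗ r)
⊗-assoc []      q r = ≈-refl
⊗-assoc (a ∷ p) q r = begin
  ((if a then q else []) ⊕ (false ∷ (p ⊗ q))) ⊗ r
    ≈⟨ ⊗-distribʳ-⊕ (if a then q else []) (false ∷ (p ⊗ q)) r ⟩
  ((if a then q else []) ⊗ r) ⊕ (false ∷ ((p ⊗ q) ⊗ r))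
    ≡⟨ cong (_⊕ (false ∷ ((p ⊗ q) ⊗ r))) (if-⊗ a q r) ⟩
  (if a then q ⊗ r else []) ⊕ (false ∷ ((p ⊗ q) ⊗ r))
    ≈⟨ ⊕-cong ≈-refl (∷-cong false (⊗-assoc p q r)) ⟩
  (if a then q ⊗ r else []) ⊕ (false ∷ (p ⊗ (q ⊗ r)))
    ∎
  where open ≈-Reasoning

-- Divisibility

infix 4 _∣_
record _∣_ (g f : Poly) : Set where
  constructor divides
  field
    quotient : Poly
    equation : quotient ⊗ g ≈ f

∣ₚ⇒∣ : ∀ {g f} → g ∣ₚ f → g ∣ f
∣ₚ⇒∣ (q , e) = divides q (mk≈ e)

∣-respʳ-≈ : ∀ {g f f′} → g ∣ f → f ≈ f′ → g ∣ f′
∣-respʳ-≈ (divides q e) f≈f′ = divides q (≈-trans e f≈f′)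

∣-respˡ-≈ : ∀ {g g′ f} → g ≈ g′ → g ∣ f → g′ ∣ f
∣-respˡ-≈ g≈g′ (divides q e) = divides q (≈-trans (⊗-congˡ q (≈-sym g≈g′)) e)

∣-refl : ∀ {g} → g ∣ g
∣-refl {g} = divides one (⊗-identityˡ g)

one-∣ : ∀ {f} → one ∣ f
one-∣ {f} = divides f (⊗-identityʳ f)

∣-trans : ∀ {g f h} → g ∣ f → f ∣ h → g ∣ h
∣-trans {g} (divides q e) (divides r e′) =
  divides (r ⊗ q) (≈-trans (⊗-assoc r q g) (≈-trans (⊗-congˡ r e) e′))

∣-⊕ : ∀ {g f h} → g ∣ f → g ∣ h → g ∣ f ⊕ h
∣-⊕ {g} (divides q e) (divides r e′) =
  divides (q ⊕ r) (≈-trans (⊗-distribʳ-⊕ q r g) (⊕-cong e e′))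

∣-⊗ˡ : ∀ {g f} h → g ∣ f → g ∣ h ⊗ f
∣-⊗ˡ {g} h (divides q e) = divides (h ⊗ q) (≈-trans (⊗-assoc h q g) (⊗-congˡ h e))

∣-⊗ʳ : ∀ {g f} h → g ∣ f → g ∣ f ⊗ h
∣-⊗ʳ {f = f} h d = ∣-respʳ-≈ (∣-⊗ˡ h d) (⊗-comm h f)

-- Lengths of normal forms (deg p = len p ∸ 1)

len : Poly → ℕ
len p = length (norm p)

length≡0⇒≡[] : ∀ (p : Poly) → length p ≡ 0 → p ≡ []
length≡0⇒≡[] [] _ = refl

normal-tail : ∀ {a b p} → Normal (a ∷ b ∷ p) → Normal (b ∷ p)
normal-tail {a} {b} {p} n = cons-injective a (norm (b ∷ p)) (trans (sym (norm-∷ a (b ∷ p))) n)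
  where
  cons-injective : ∀ a r → cons a r ≡ a ∷ b ∷ p → r ≡ b ∷ p
  cons-injective true  [] ()
  cons-injective false [] ()
  cons-injective a (_ ∷ _) refl = refl

normal-singleton : ∀ {a} → Normal (a ∷ []) → a ≡ true
normal-singleton {true} _ = refl

length-cons : ∀ a p → length (cons a p) ≤ suc (length p)
length-cons true  []      = ≤-refl
length-cons false []      = z≤n
length-cons a     (_ ∷ _) = ≤-refl

cons-nonempty : ∀ a p → 0 < length p → cons a p ≡ a ∷ p
cons-nonempty a (_ ∷ _) _ = refl

-- The leading coefficients of two normal polynomials of equal length cancel.
len-⊕-equalLength : ∀ {f g} → length f ≡ length g → Normal f → Normal g → 0 < length f →
                    len (f ⊕ g) < length f
len-⊕-equalLength {a ∷ f} {b ∷ g} l nf ng _ = s≤s (cancel a f b g (suc-injective l) nf ng)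
  where
  cancel : ∀ a f b g → length f ≡ length g → Normal (a ∷ f) → Normal (b ∷ g) →
           len ((a ∷ f) ⊕ (b ∷ g)) ≤ length f
  cancel a [] b [] _ nf ng rewrite normal-singleton nf | normal-singleton ng = z≤n
  cancel a (c ∷ f) b (d ∷ g) l nf ng = begin
    length (norm ((a xor b) ∷ ((c ∷ f) ⊕ (d ∷ g))))
      ≡⟨ cong length (norm-∷ (a xor b) ((c ∷ f) ⊕ (d ∷ g))) ⟩
    length (cons (a xor b) (norm ((c ∷ f) ⊕ (d ∷ g))))
      ≤⟨ length-cons (a xor b) (norm ((c ∷ f) ⊕ (d ∷ g))) ⟩
    suc (len ((c ∷ f) ⊕ (d ∷ g)))
      ≤⟨ s≤s (cancel c f d g (suc-injective l) (normal-tail nf) (normal-tail ng)) ⟩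
    suc (length f)
      ∎
    where open ≤-Reasoning

len-⊕-longer : ∀ p q → length p < length q → Normal q → len (p ⊕ q) ≡ length q
len-⊕-longer []      q           _       nq = cong length nq
len-⊕-longer (a ∷ p) (b ∷ c ∷ q) (s≤s l) nq = begin
  length (norm ((a xor b) ∷ (p ⊕ (c ∷ q))))          ≡⟨ cong length (norm-∷ (a xor b) (p ⊕ (c ∷ q))) ⟩
  length (cons (a xor b) (norm (p ⊕ (c ∷ q))))       ≡⟨ cong length (cons-nonempty (a xor b) (norm (p ⊕ (c ∷ q))) nonempty) ⟩
  suc (len (p ⊕ (c ∷ q)))                            ≡⟨ cong suc ih ⟩
  suc (length (c ∷ q))                               ∎
  where
  open ≡-Reasoning
  ih : len (p ⊕ (c ∷ q)) ≡ length (c ∷ q)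
  ih = len-⊕-longer p (c ∷ q) l (normal-tail nq)
  nonempty : 0 < len (p ⊕ (c ∷ q))
  nonempty = subst (0 <_) (sym ih) z<s

length-if : ∀ a (p : Poly) → length (if a then p else []) ≤ length p
length-if true  p = ≤-refl
length-if false p = z≤n

len-⊗-normal : ∀ a p q → Normal (a ∷ p) → Normal q → 0 < length q →
               len ((a ∷ p) ⊗ q) ≡ length p + length q
len-⊗-normal a []      q np nq _ rewrite normal-singleton np =
  trans (cong length (norm-≡ (⊗-identityˡ q))) (cong length nq)
len-⊗-normal a (b ∷ p) q np nq q≢[] = begin
  len ((if a then q else []) ⊕ (false ∷ ((b ∷ p) ⊗ q)))   ≡⟨ cong length (norm-≡ normalise-tail) ⟩
  len ((if a then q else []) ⊕ (false ∷ r))               ≡⟨ len-⊕-longer (if a then q else []) (false ∷ r) shorter r-normal ⟩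
  suc (length r)                                          ≡⟨ cong suc ih ⟩
  suc (length p + length q)                               ∎
  where
  open ≡-Reasoning
  r : Poly
  r = norm ((b ∷ p) ⊗ q)
  ih : length r ≡ length p + length q
  ih = len-⊗-normal b p q (normal-tail np) nq q≢[]
  q≤r : length q ≤ length r
  q≤r = subst (length q ≤_) (sym ih) (m≤n+m (length q) (length p))
  r-normal : Normal (false ∷ r)
  r-normal = trans (norm-∷ false r) (trans (cong (cons false) (norm-idem ((b ∷ p) ⊗ q)))
                   (cons-nonempty false r (≤-trans q≢[] q≤r)))
  normalise-tail : (if a then q else []) ⊕ (false ∷ ((b ∷ p) ⊗ q)) ≈ (if a then q else []) ⊕ (false ∷ r)
  normalise-tail = ⊕-cong ≈-refl (∷-cong false (≈-sym (norm-≈ ((b ∷ p) ⊗ q))))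
  shorter : length (if a then q else []) < length (false ∷ r)
  shorter = s≤s (≤-trans (length-if a q) q≤r)

len-⊗ : ∀ p q {m n} → len p ≡ suc m → len q ≡ suc n → len (p ⊗ q) ≡ suc (m + n)
len-⊗ p q {m} {n} lp lq = begin
  len (p ⊗ q)             ≡⟨ cong length (norm-≡ (≈-trans (⊗-normˡ p q) (⊗-normʳ (norm p) q))) ⟩
  len (norm p ⊗ norm q)   ≡⟨ normal-product (norm p) (norm-idem p) lp ⟩
  suc (m + n)             ∎
  where
  open ≡-Reasoning
  normal-product : ∀ r → Normal r → length r ≡ suc m → len (r ⊗ norm q) ≡ suc (m + n)
  normal-product (a ∷ r) nr lr =
    trans (len-⊗-normal a r (norm q) nr (norm-idem q) (subst (0 <_) (sym lq) z<s))
          (trans (cong₂ _+_ (suc-injective lr) lq) (+-suc m n))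

len-⊗-zeroˡ : ∀ p q → len p ≡ 0 → len (p ⊗ q) ≡ 0
len-⊗-zeroˡ p q lp =
  cong length (trans (norm-≡ (⊗-normˡ p q)) (cong (λ r → norm (r ⊗ q)) (length≡0⇒≡[] (norm p) lp)))

len≤len-⊗ : ∀ q g → 0 < len (q ⊗ g) → len g ≤ len (q ⊗ g)
len≤len-⊗ q g q⊗g≢0 with len g in lg | len q in lq
... | zero  | _     = z≤n
... | suc _ | zero  = ⊥-elim (n≮0 (subst (0 <_) (len-⊗-zeroˡ q g lq) q⊗g≢0))
... | suc m | suc n = subst (suc m ≤_) (sym (len-⊗ q g lq lg)) (s≤s (m≤n+m m n))

∣⇒len≤ : ∀ {g f} → g ∣ f → 0 < len f → len g ≤ len f
∣⇒len≤ {g} {f} (divides q q⊗g≈f) f≢0 =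
  subst (len g ≤_) len-q⊗g≡len-f (len≤len-⊗ q g (subst (0 <_) (sym len-q⊗g≡len-f) f≢0))
  where
  len-q⊗g≡len-f : len (q ⊗ g) ≡ len f
  len-q⊗g≡len-f = cong length (norm-≡ q⊗g≈f)

∣⇒deg≤ : ∀ {g f} → g ∣ f → 0 < len f → deg g ≤ deg f
∣⇒deg≤ g∣f f≢0 = ∸-monoˡ-≤ 1 (∣⇒len≤ g∣f f≢0)

shift : ℕ → Poly → Poly
shift k p = replicate k false ++ p

xpow : ℕ → Poly
xpow k = shift k one

xpow-⊗ : ∀ k p → xpow k ⊗ p ≈ shift k p
xpow-⊗ zero    p = ⊗-identityˡ p
xpow-⊗ (suc k) p = ∷-cong false (xpow-⊗ k p)

shift-cong : ∀ k {p q} → p ≈ q → shift k p ≈ shift k q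
shift-cong zero    p≈q = p≈q
shift-cong (suc k) p≈q = ∷-cong false (shift-cong k p≈q)

length-shift : ∀ k p → length (shift k p) ≡ k + length p
length-shift k p = trans (length-++ (replicate k false)) (cong (_+ length p) (length-replicate k))

shift-normal : ∀ k {p} → Normal p → 0 < length p → Normal (shift k p)
shift-normal zero    np p≢[] = np
shift-normal (suc k) {p} np p≢[] = begin
  norm (false ∷ shift k p)     ≡⟨ norm-∷ false (shift k p) ⟩
  cons false (norm (shift k p)) ≡⟨ cong (cons false) (shift-normal k np p≢[]) ⟩
  cons false (shift k p)        ≡⟨ cons-nonempty false (shift k p) nonempty ⟩
  false ∷ shift k p             ∎
  where
  open ≡-Reasoning
  nonempty : 0 < length (shift k p)
  nonempty = subst (0 <_) (sym (length-shift k p)) (≤-trans p≢[] (m≤n+m (length p) k))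

len-⊕-cancelLeading : ∀ a b k → 0 < len b → len a ≡ k + len b → len (a ⊕ (xpow k ⊗ b)) < len a
len-⊕-cancelLeading a b k b≢0 la = subst (_< len a) (cong length (norm-≡ (≈-sym to-normal))) shorter
  where
  to-normal : a ⊕ (xpow k ⊗ b) ≈ norm a ⊕ shift k (norm b)
  to-normal = ⊕-cong (≈-sym (norm-≈ a)) (≈-trans (xpow-⊗ k b) (shift-cong k (≈-sym (norm-≈ b))))
  shorter : len (norm a ⊕ shift k (norm b)) < len a
  shorter = len-⊕-equalLength (trans la (sym (length-shift k (norm b))))
              (norm-idem a) (shift-normal k (norm-idem b) b≢0)
              (subst (0 <_) (sym la) (≤-trans b≢0 (m≤n+m (len b) k)))

-- Bézout identity and Euclid's lemma

record Bézout (a b : Poly) : Set where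
  constructor mkBézout
  field
    gcd u v  : Poly
    identity : gcd ≈ (u ⊗ a) ⊕ (v ⊗ b)
    gcd∣a    : gcd ∣ a
    gcd∣b    : gcd ∣ b

Bézout-swap : ∀ {a b} → Bézout a b → Bézout b a
Bézout-swap {a} {b} (mkBézout g u v g≈ua+vb g∣a g∣b) =
  mkBézout g v u (≈-trans g≈ua+vb (≡⇒≈ (⊕-comm (u ⊗ a) (v ⊗ b)))) g∣b g∣a

Bézout-zeroˡ : ∀ {a b} → len a ≡ 0 → Bézout a b
Bézout-zeroˡ {a} {b} la = mkBézout b [] one (≈-sym (⊗-identityˡ b)) b∣a ∣-refl
  where
  b∣a : b ∣ a
  b∣a = divides [] (mk≈ (sym (length≡0⇒≡[] (norm a) la)))

-- In characteristic 2, a = (a + c b) + c b.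
Bézout-reduce : ∀ {a b} c → Bézout (a ⊕ (c ⊗ b)) b → Bézout a b
Bézout-reduce {a} {b} c (mkBézout g u v g≈ua′+vb g∣a′ g∣b) =
  mkBézout g u ((u ⊗ c) ⊕ v) identity g∣a g∣b
  where
  open ≈-Reasoning
  identity : g ≈ (u ⊗ a) ⊕ (((u ⊗ c) ⊕ v) ⊗ b)
  identity = begin
    g                                       ≈⟨ g≈ua′+vb ⟩
    (u ⊗ (a ⊕ (c ⊗ b))) ⊕ (v ⊗ b)           ≡⟨ cong (_⊕ (v ⊗ b)) (⊗-distribˡ-⊕ u a (c ⊗ b)) ⟩
    ((u ⊗ a) ⊕ (u ⊗ (c ⊗ b))) ⊕ (v ⊗ b)     ≡⟨ ⊕-assoc (u ⊗ a) (u ⊗ (c ⊗ b)) (v ⊗ b) ⟩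
    (u ⊗ a) ⊕ ((u ⊗ (c ⊗ b)) ⊕ (v ⊗ b))     ≈⟨ ⊕-congˡ (u ⊗ a) (⊕-congʳ (v ⊗ b) (≈-sym (⊗-assoc u c b))) ⟩
    (u ⊗ a) ⊕ (((u ⊗ c) ⊗ b) ⊕ (v ⊗ b))     ≈⟨ ⊕-congˡ (u ⊗ a) (≈-sym (⊗-distribʳ-⊕ (u ⊗ c) v b)) ⟩
    (u ⊗ a) ⊕ (((u ⊗ c) ⊕ v) ⊗ b)           ∎
  g∣a : g ∣ a
  g∣a = ∣-respʳ-≈ (∣-⊕ g∣a′ (∣-⊗ˡ c g∣b)) (⊕-cancelʳ a (c ⊗ b))

Bézout-step : ∀ {n a b} → (∀ a′ b′ → len a′ + len b′ ≤ n → Bézout a′ b′) →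
              len b ≤ len a → 0 < len b → len a + len b ≤ suc n → Bézout a b
Bézout-step {n} {a} {b} recurse b≤a b≢0 bound =
  Bézout-reduce (xpow k) (recurse (a ⊕ (xpow k ⊗ b)) b smaller)
  where
  k : ℕ
  k = len a ∸ len b
  smaller : len (a ⊕ (xpow k ⊗ b)) + len b ≤ n
  smaller = ≤-pred (≤-trans (+-monoˡ-< (len b) (len-⊕-cancelLeading a b k b≢0 (sym (m∸n+n≡m b≤a)))) bound)

bézout-bounded : ∀ n a b → len a + len b ≤ n → Bézout a b
bézout-bounded zero    a b bound = Bézout-zeroˡ (m+n≡0⇒m≡0 (len a) (n≤0⇒n≡0 bound))
bézout-bounded (suc n) a b bound with len a ≟ 0 | len b ≟ 0 | ≤-total (len b) (len a)
... | yes a≡0 | _       | _       = Bézout-zeroˡ a≡0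
... | no _    | yes b≡0 | _       = Bézout-swap (Bézout-zeroˡ b≡0)
... | no _    | no b≢0  | inj₁ b≤a = Bézout-step (bézout-bounded n) b≤a (n≢0⇒n>0 b≢0) bound
... | no a≢0  | no _    | inj₂ a≤b = Bézout-swap
  (Bézout-step (bézout-bounded n) a≤b (n≢0⇒n>0 a≢0) (subst (_≤ suc n) (+-comm (len a) (len b)) bound))

bézout : ∀ a b → Bézout a b
bézout a b = bézout-bounded (len a + len b) a b ≤-refl

euclidsLemma : ∀ a b {p} → Irreducible p → p ∣ a ⊗ b → p ∣ a ⊎ p ∣ b
euclidsLemma a b {p} (p-normal , _ , p-irreducible) p∣ab
  with bézout p a
... | mkBézout g u v g≈up+va (divides r r⊗g≈p) g∣a
  with p-irreducible r g (trans (norm-≡ r⊗g≈p) p-normal)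
... | inj₁ r≈one = inj₁ (∣-respˡ-≈ g≈p g∣a)
  where
  open ≈-Reasoning
  g≈p : g ≈ p
  g≈p = begin
    g        ≈⟨ ≈-sym (⊗-identityˡ g) ⟩
    one ⊗ g  ≈⟨ ⊗-congʳ g (mk≈ {one} {r} (sym r≈one)) ⟩
    r ⊗ g    ≈⟨ r⊗g≈p ⟩
    p        ∎
... | inj₂ g≈one = inj₂ (∣-respʳ-≈ (∣-⊕ p∣upb p∣vab) upb+vab≈b)
  where
  open ≈-Reasoning
  p∣upb : p ∣ (u ⊗ p) ⊗ b
  p∣upb = ∣-⊗ʳ b (∣-⊗ˡ u ∣-refl)
  p∣vab : p ∣ (v ⊗ a) ⊗ b
  p∣vab = ∣-respʳ-≈ (∣-⊗ˡ v p∣ab) (≈-sym (⊗-assoc v a b))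
  upb+vab≈b : ((u ⊗ p) ⊗ b) ⊕ ((v ⊗ a) ⊗ b) ≈ b
  upb+vab≈b = begin
    ((u ⊗ p) ⊗ b) ⊕ ((v ⊗ a) ⊗ b)  ≈⟨ ≈-sym (⊗-distribʳ-⊕ (u ⊗ p) (v ⊗ a) b) ⟩
    ((u ⊗ p) ⊕ (v ⊗ a)) ⊗ b        ≈⟨ ⊗-congʳ b (≈-sym g≈up+va) ⟩
    g ⊗ b                          ≈⟨ ⊗-congʳ b (mk≈ {g} {one} g≈one) ⟩
    one ⊗ b                        ≈⟨ ⊗-identityˡ b ⟩
    b                              ∎

irreducible∤one : ∀ {p} → Irreducible p → ¬ p ∣ one
irreducible∤one (_ , deg≥1 , _) p∣one = n≮0 (≤-trans deg≥1 (∣⇒deg≤ p∣one z<s))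

irreducible∣irreducible⇒≡ : ∀ {p r} → Irreducible p → Irreducible r → p ∣ r → p ≡ r
irreducible∣irreducible⇒≡ {p} {r} (p-normal , deg≥1 , _) (r-normal , _ , r-irreducible) (divides q q⊗p≈r)
  with r-irreducible q p (trans (norm-≡ q⊗p≈r) r-normal)
... | inj₁ q≈one = trans (sym p-normal) (trans (norm-≡ p≈r) r-normal)
  where
  open ≈-Reasoning
  p≈r : p ≈ r
  p≈r = begin
    p        ≈⟨ ≈-sym (⊗-identityˡ p) ⟩
    one ⊗ p  ≈⟨ ⊗-congʳ p (mk≈ {one} {q} (sym q≈one)) ⟩
    q ⊗ p    ≈⟨ q⊗p≈r ⟩
    r        ∎
... | inj₂ p≈one = ⊥-elim (n≮0 (subst (λ w → 1 ≤ length w ∸ 1) p≈one deg≥1))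

irreducible∤prodList : ∀ {p L} → Irreducible p → All Irreducible L → All (p ≢_) L → ¬ p ∣ prodList L
irreducible∤prodList p-irr []               []            p∣one = irreducible∤one p-irr p∣one
irreducible∤prodList {L = r ∷ L} p-irr (r-irr ∷ L-irr) (p≢r ∷ p∉L) p∣rL with euclidsLemma r (prodList L) p-irr p∣rL
... | inj₁ p∣r = p≢r (irreducible∣irreducible⇒≡ p-irr r-irr p∣r)
... | inj₂ p∣L = irreducible∤prodList p-irr L-irr p∉L p∣L

prodList-∣ : ∀ {f L} → Unique L → All (λ p → Irreducible p × p ∣ f) L → prodList L ∣ f
prodList-∣ []             []                       = one-∣
prodList-∣ {f} {p ∷ L} (p∉L ∷ unique) ((p-irr , p∣f) ∷ factors)
  with prodList-∣ unique factors
... | divides q q⊗L≈f with euclidsLemma q (prodList L) p-irr (∣-respʳ-≈ p∣f (≈-sym q⊗L≈f))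
... | inj₁ (divides q′ q′⊗p≈q) = divides q′ (begin
  q′ ⊗ (p ⊗ prodList L)   ≈⟨ ≈-sym (⊗-assoc q′ p (prodList L)) ⟩
  (q′ ⊗ p) ⊗ prodList L   ≈⟨ ⊗-congʳ (prodList L) q′⊗p≈q ⟩
  q ⊗ prodList L          ≈⟨ q⊗L≈f ⟩
  f                       ∎)
  where open ≈-Reasoning
... | inj₂ p∣L = ⊥-elim (irreducible∤prodList p-irr (All.map proj₁ factors) p∉L p∣L)

-- Geometric sums 1 + x + ⋯ + xⁿ

replicate-⊕-shift : ∀ m n → replicate m true ⊕ shift m (replicate n true) ≡ replicate (m + n) true
replicate-⊕-shift zero    n = refl
replicate-⊕-shift (suc m) n = cong (true ∷_) (replicate-⊕-shift m n)

replicate-⊕-replicate-suc : ∀ j → replicate j true ⊕ replicate (suc j) true ≡ xpow j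
replicate-⊕-replicate-suc zero    = refl
replicate-⊕-replicate-suc (suc j) = cong (false ∷_) (replicate-⊕-replicate-suc j)

[1+x]⊗geom : ∀ j → (one ⊕ X) ⊗ geom j ≈ one ⊕ xpow (suc j)
[1+x]⊗geom j = ≈-trans (⊕-congˡ (geom j) (∷-cong false (⊗-identityˡ (geom j))))
                       (≡⇒≈ (cong (true ∷_) (replicate-⊕-replicate-suc j)))

geom-odd : ∀ j → geom (suc (j + j)) ≈ geom j ⊗ ((one ⊕ X) ⊗ geom j)
geom-odd j = ≈-sym (begin
  geom j ⊗ ((one ⊕ X) ⊗ geom j)               ≈⟨ ⊗-congˡ (geom j) ([1+x]⊗geom j) ⟩
  geom j ⊗ (one ⊕ xpow (suc j))               ≡⟨ ⊗-distribˡ-⊕ (geom j) one (xpow (suc j)) ⟩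
  (geom j ⊗ one) ⊕ (geom j ⊗ xpow (suc j))    ≈⟨ ⊕-cong (⊗-identityʳ (geom j)) x^[j+1]⊗geom ⟩
  geom j ⊕ shift (suc j) (geom j)             ≡⟨ replicate-⊕-shift (suc j) (suc j) ⟩
  replicate (suc j + suc j) true              ≡⟨ cong (λ n → replicate (suc n) true) (+-suc j j) ⟩
  geom (suc (j + j))                          ∎)
  where
  open ≈-Reasoning
  x^[j+1]⊗geom : geom j ⊗ xpow (suc j) ≈ shift (suc j) (geom j)
  x^[j+1]⊗geom = ≈-trans (⊗-comm (geom j) (xpow (suc j))) (xpow-⊗ (suc j) (geom j))

geom-normal : ∀ n → Normal (geom n)
geom-normal zero    = refl
geom-normal (suc n) = trans (norm-∷ true (geom n)) (cong (cons true) (geom-normal n))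

len-geom : ∀ n → len (geom n) ≡ suc n
len-geom n = trans (cong length (geom-normal n)) (length-replicate (suc n))

data Parity : ℕ → Set where
  even : ∀ j → Parity (j + j)
  odd  : ∀ j → Parity (suc (j + j))

parity : ∀ n → Parity n
parity zero = even 0
parity (suc n) with parity n
... | even j = odd j
... | odd j  = subst Parity (cong suc (+-suc j j)) (even (suc j))

DividesOnePlusXOrEvenGeom : ℕ → Poly → Set
DividesOnePlusXOrEvenGeom n p = p ∣ one ⊕ X ⊎ ∃[ j ] j + j ≤ n × p ∣ geom (j + j)

DividesOnePlusXOrEvenGeom-mono : ∀ {m n p} → m ≤ n → DividesOnePlusXOrEvenGeom m p → DividesOnePlusXOrEvenGeom n p
DividesOnePlusXOrEvenGeom-mono m≤n (inj₁ p∣1+x)              = inj₁ p∣1+x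
DividesOnePlusXOrEvenGeom-mono m≤n (inj₂ (j , j+j≤m , p∣geom)) = inj₂ (j , ≤-trans j+j≤m m≤n , p∣geom)

irreducible∣geom-odd : ∀ {p} j → Irreducible p → p ∣ geom (suc (j + j)) → p ∣ one ⊕ X ⊎ p ∣ geom j
irreducible∣geom-odd j p-irr p∣geom
  with euclidsLemma (geom j) ((one ⊕ X) ⊗ geom j) p-irr (∣-respʳ-≈ p∣geom (geom-odd j))
... | inj₁ p∣geom-j           = inj₂ p∣geom-j
... | inj₂ p∣[1+x]⊗geom-j = euclidsLemma (one ⊕ X) (geom j) p-irr p∣[1+x]⊗geom-j

irreducible∣geom : ∀ {p} → Irreducible p → ∀ n → p ∣ geom n → DividesOnePlusXOrEvenGeom n p
irreducible∣geom {p} p-irr = <-rec (λ n → p ∣ geom n → DividesOnePlusXOrEvenGeom n p) go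
  where
  go : ∀ n → (∀ {m} → m < n → p ∣ geom m → DividesOnePlusXOrEvenGeom m p) → p ∣ geom n → DividesOnePlusXOrEvenGeom n p
  go n rec p∣geom with parity n
  ... | even j = inj₂ (j , ≤-refl , p∣geom)
  ... | odd j with irreducible∣geom-odd j p-irr p∣geom
  ...   | inj₁ p∣1+x    = inj₁ p∣1+x
  ...   | inj₂ p∣geom-j =
    DividesOnePlusXOrEvenGeom-mono (m≤n⇒m≤1+n (m≤m+n j j)) (rec (s≤s (m≤m+n j j)) p∣geom-j)

irreducible∣prodGeom : ∀ {p} → Irreducible p → ∀ t → p ∣ prodGeom t → ∃[ i ] i ≤ t × p ∣ geom i
irreducible∣prodGeom p-irr zero    p∣one  = 0 , z≤n , p∣one
irreducible∣prodGeom p-irr (suc t) p∣prod with euclidsLemma (prodGeom t) (geom (suc t)) p-irr p∣prod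
... | inj₂ p∣geom = suc t , ≤-refl , p∣geom
... | inj₁ p∣prod′ with irreducible∣prodGeom p-irr t p∣prod′
...   | i , i≤t , p∣geom = i , m≤n⇒m≤1+n i≤t , p∣geom

-- The polynomial x (1 + x) ∏_{j=1}^{m} (1 + x + ⋯ + x^(2j))

evenGeoms : ℕ → Poly
evenGeoms zero    = one
evenGeoms (suc j) = geom (suc j + suc j) ⊗ evenGeoms j

D : ℕ → Poly
D m = X ⊗ ((one ⊕ X) ⊗ evenGeoms m)

geom-even-∣-evenGeoms : ∀ {j} m → j ≤ m → geom (j + j) ∣ evenGeoms m
geom-even-∣-evenGeoms {zero}  m       _   = one-∣
geom-even-∣-evenGeoms {suc j} (suc m) j≤m with m≤n⇒m<n∨m≡n j≤m
... | inj₁ j<m  = ∣-⊗ˡ (geom (suc m + suc m)) (geom-even-∣-evenGeoms m (≤-pred j<m))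
... | inj₂ refl = ∣-⊗ʳ (evenGeoms m) ∣-refl

irreducible∣Π₂⇒∣D : ∀ {p} t → Irreducible p → p ∣ Π₂ t → p ∣ D ⌊ t /2⌋
irreducible∣Π₂⇒∣D t p-irr p∣Π₂ with euclidsLemma X (prodGeom t) p-irr p∣Π₂
... | inj₁ p∣X = ∣-⊗ʳ ((one ⊕ X) ⊗ evenGeoms ⌊ t /2⌋) p∣X
... | inj₂ p∣prod with irreducible∣prodGeom p-irr t p∣prod
... | i , i≤t , p∣geom with irreducible∣geom p-irr i p∣geom
... | inj₁ p∣1+x = ∣-⊗ˡ X (∣-⊗ʳ (evenGeoms ⌊ t /2⌋) p∣1+x)
... | inj₂ (j , j+j≤i , p∣geom-2j) =
  ∣-⊗ˡ X (∣-⊗ˡ (one ⊕ X) (∣-trans p∣geom-2j (geom-even-∣-evenGeoms ⌊ t /2⌋ j≤⌊t/2⌋)))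
  where
  j≤⌊t/2⌋ : j ≤ ⌊ t /2⌋
  j≤⌊t/2⌋ = subst (_≤ ⌊ t /2⌋) (sym (n≡⌊n+n/2⌋ j)) (⌊n/2⌋-mono (≤-trans j+j≤i i≤t))

len-evenGeoms : ∀ m → len (evenGeoms m) ≡ suc (m * suc m)
len-evenGeoms zero    = refl
len-evenGeoms (suc j) =
  trans (len-⊗ (geom (suc j + suc j)) (evenGeoms j) (len-geom (suc j + suc j)) (len-evenGeoms j))
        (cong suc (arithmetic j))
  where
  arithmetic : ∀ j → (suc j + suc j) + j * suc j ≡ suc j * suc (suc j)
  arithmetic = solve-∀

len-D : ∀ m → len (D m) ≡ 3 + m * suc m
len-D m = len-⊗ X ((one ⊕ X) ⊗ evenGeoms m) refl (len-⊗ (one ⊕ X) (evenGeoms m) refl (len-evenGeoms m))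

2+[1+k][2+k]≤[2+k]² : ∀ k → 2 + suc k * suc (suc k) ≤ suc (suc k) ^ 2
2+[1+k][2+k]≤[2+k]² k = begin
  2 + suc k * suc (suc k)        ≤⟨ m≤n+m _ k ⟩
  k + (2 + suc k * suc (suc k))  ≡⟨ square k ⟩
  suc (suc k) ^ 2                ∎
  where
  open ≤-Reasoning
  square : ∀ k → k + (2 + suc k * suc (suc k)) ≡ suc (suc k) * (suc (suc k) * 1)
  square = solve-∀

corollary3p6 : (t : ℕ) → 2 ≤ t → (L : List Poly) → Unique L →
    ((p : Poly) → (p ∈ L → Irreducible p × (p ∣ₚ Π₂ t)) × (Irreducible p × (p ∣ₚ Π₂ t) → p ∈ L)) →
    deg (prodList L) ≤ ⌈ suc t /2⌉ ^ 2
corollary3p6 (suc zero)    (s≤s ())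
corollary3p6 (suc (suc t)) _ L unique factors-of-Π₂ = begin
  deg (prodList L)  ≤⟨ ∣⇒deg≤ (prodList-∣ unique factors) (subst (0 <_) (sym (len-D m)) z<s) ⟩
  deg (D m)         ≡⟨ cong (_∸ 1) (len-D m) ⟩
  2 + m * suc m     ≤⟨ 2+[1+k][2+k]≤[2+k]² ⌊ t /2⌋ ⟩
  suc m ^ 2         ∎
  where
  open ≤-Reasoning
  m : ℕ
  m = suc ⌊ t /2⌋
  factors : All (λ p → Irreducible p × p ∣ D m) L
  factors = All.tabulate λ {p} p∈L →
    let (p-irr , p∣Π₂) = proj₁ (factors-of-Π₂ p) p∈L
    in  p-irr , irreducible∣Π₂⇒∣D (suc (suc t)) p-irr (∣ₚ⇒∣ p∣Π₂)
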